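{- Let $t:\mathcal{L}_{FH}\to\mathcal{L}_{AIL}$ be the translation defined by $t(p)=p$, $t(\neg\varphi)=\neg t(\varphi)$, $t(\varphi\wedge\psi)=t(\varphi)\wedge t(\psi)$, $t(A_i\varphi)=A_i t(\varphi)$, $t(I_i\varphi)=I_i t(\varphi)$, and $t(E_i\varphi)=A_i t(\varphi)\wedge I_i t(\varphi)$. Then for every $\varphi\in\mathcal{L}_{FH}$: $\varphi$ is valid under $\vDash_{FH}$ (true at every world of every epistemic model with awareness) iff $t(\varphi)$ is valid under $\vDash_{AIL}$.
   Context: Let $\mathcal{P}$ be a countable set of atomic propositions and $\mathcal{G}$ a finite set of agents. The language $\mathcal{L}_{AIL}$ is generated by $\varphi::= p\mid\neg\varphi\mid\varphi\wedge\varphi\mid A_i\varphi\mid I_i\varphi\mid E_i\varphi\mid[\approx]_i\varphi\mid[\circ^+]_i\varphi$ ($p\in\mathcal{P}$, $i\in\mathcal{G}$); $\mathcal{L}_{FH}$ is generated by $\varphi::= p\mid\neg\varphi\mid\varphi\wedge\varphi\mid A_i\varphi\mid I_i\varphi\mid E_i\varphi$. $At(\varphi)$ is the set of atomic propositions occurring in $\varphi$. An epistemic model with awareness is $M=\langle W,\{\sim_i,\mathscr{A}_i\}_{i\in\mathcal{G}},V\rangle$ where $W\neq\emptyset$, each $\sim_i$ is an equivalence relation on $W$, each $\mathscr{A}_i:W\to 2^{\mathcal{P}}$ satisfies: if $(w,v)\in\sim_i$ then $\mathscr{A}_i(w)=\mathscr{A}_i(v)$, and $V:\mathcal{P}\to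 2^W$. The A-equivalence relation $\approx_i$: $(w,v)\in\approx_i$ iff $\mathscr{A}_i(w)=\mathscr{A}_i(v)$ and for every $p\in\mathscr{A}_i(w)$, $w\in V(p)$ iff $v\in V(p)$. Let $\sim_i\circ\approx_i=\{(w,u)\mid\exists t\,((w,t)\in\approx_i,(t,u)\in\sim_i)\}$ and $(\sim_i\circ\approx_i)^+$ its transitive closure. Semantics $\vDash_{AIL}$: $M,w\vDash p$ iff $w\in V(p)$; Boolean clauses as usual; $M,w\vDash A_i\varphi$ iff $At(\varphi)\subseteq\mathscr{A}_i(w)$; $M,w\vDash I_i\varphi$ iff $\varphi$ holds at all $v$ with $(w,v)\in\sim_i$; $M,w\vDash[\approx]_i\varphi$ iff $\varphi$ holds at all $v$ with $(w,v)\in\approx_i$; $M,w\vDash[\circ^+]_i\varphi$ iff $\varphi$ holds at all $v$ with $(w,v)\in(\sim_i\circ\approx_i)^+$; $M,w\vDash E_i\varphi$ iff $M,w\vDash A_i\varphi$ and $M,w\vDash[\circ^+]_i\varphi$. Semantics $\vDash_{FH}$ for $\mathcal{L}_{FH}$ on the same models: same clauses for atoms, Booleans, $A_i$, $I_i$, but $M,w\vDash_{FH}E_i\varphi$ iff $M,w\vDash_{FH}A_i\varphi$ and $M,w\vDash_{FH}I_i\varphi$. -}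

module Defs where

open import Level using (0ℓ)
open import Data.Nat using (ℕ)
open import Data.Fin using (Fin)
open import Data.Product using (_×_; Σ; ∃)
open import Data.Empty using (⊥)
open import Function.Bundles using (_⇔_)
open import Relation.Binary.Core using (Rel)
open import Relation.Binary.Structures using (IsEquivalence)
open import Relation.Binary.Construct.Closure.Transitive using (TransClosure)

Atom : Set
Atom = ℕ

data AIL (g : ℕ) : Set where
  atom : Atom → AIL g
  ¬ₐ_  : AIL g → AIL g
  _∧ₐ_ : AIL g → AIL g → AIL g
  Aₐ Iₐ Eₐ : Fin g → AIL g → AIL g
  [≈]  : Fin g → AIL g → AIL g
  [∘⁺] : Fin g → AIL g → AIL g

data FH (g : ℕ) : Set where
  atom : Atom → FH g
  ¬f_  : FH g → FH g
  _∧f_ : FH g → FH g → FH g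
  Af If Ef : Fin g → FH g → FH g

data OccAIL {g : ℕ} (p : Atom) : AIL g → Set where
  atom : OccAIL p (atom p)
  neg  : ∀ {φ} → OccAIL p φ → OccAIL p (¬ₐ φ)
  andl : ∀ {φ ψ} → OccAIL p φ → OccAIL p (φ ∧ₐ ψ)
  andr : ∀ {φ ψ} → OccAIL p ψ → OccAIL p (φ ∧ₐ ψ)
  aw   : ∀ {i φ} → OccAIL p φ → OccAIL p (Aₐ i φ)
  inf  : ∀ {i φ} → OccAIL p φ → OccAIL p (Iₐ i φ)
  ex   : ∀ {i φ} → OccAIL p φ → OccAIL p (Eₐ i φ)
  aeq  : ∀ {i φ} → OccAIL p φ → OccAIL p ([≈] i φ)
  cmp  : ∀ {i φ} → OccAIL p φ → OccAIL p ([∘⁺] i φ)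

data OccFH {g : ℕ} (p : Atom) : FH g → Set where
  atom : OccFH p (atom p)
  neg  : ∀ {φ} → OccFH p φ → OccFH p (¬f φ)
  andl : ∀ {φ ψ} → OccFH p φ → OccFH p (φ ∧f ψ)
  andr : ∀ {φ ψ} → OccFH p ψ → OccFH p (φ ∧f ψ)
  aw   : ∀ {i φ} → OccFH p φ → OccFH p (Af i φ)
  inf  : ∀ {i φ} → OccFH p φ → OccFH p (If i φ)
  ex   : ∀ {i φ} → OccFH p φ → OccFH p (Ef i φ)

-- Epistemic model with awareness. Subsets of W / of 𝒫 are predicates;
-- equality of awareness sets is extensional (pointwise ⇔).
record Model (g : ℕ) : Set₁ where
  field
    W     : Set
    inhabited : W
    ∼     : Fin g → Rel W 0ℓ
    ∼-equiv : ∀ i → IsEquivalence (∼ i)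
    𝒜     : Fin g → W → Atom → Set
    𝒜-∼   : ∀ i {w v} → ∼ i w v → ∀ p → (𝒜 i w p ⇔ 𝒜 i v p)
    V     : Atom → W → Set

  ≈ : Fin g → Rel W 0ℓ
  ≈ i w v = (∀ p → (𝒜 i w p ⇔ 𝒜 i v p))
          × (∀ p → 𝒜 i w p → (V p w ⇔ V p v))

  ∼∘≈ : Fin g → Rel W 0ℓ
  ∼∘≈ i w u = ∃ λ t → ≈ i w t × ∼ i t u

  ∘⁺ : Fin g → Rel W 0ℓ
  ∘⁺ i = TransClosure (∼∘≈ i)

open Model public

_,_⊨ₐ_ : ∀ {g} (M : Model g) → W M → AIL g → Set
M , w ⊨ₐ atom p = V M p w
M , w ⊨ₐ (¬ₐ φ) = M , w ⊨ₐ φ → ⊥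
M , w ⊨ₐ (φ ∧ₐ ψ) = (M , w ⊨ₐ φ) × (M , w ⊨ₐ ψ)
M , w ⊨ₐ Aₐ i φ = ∀ p → OccAIL p φ → 𝒜 M i w p
M , w ⊨ₐ Iₐ i φ = ∀ v → ∼ M i w v → M , v ⊨ₐ φ
M , w ⊨ₐ Eₐ i φ = (∀ p → OccAIL p φ → 𝒜 M i w p)
                 × (∀ v → ∘⁺ M i w v → M , v ⊨ₐ φ)
M , w ⊨ₐ [≈] i φ = ∀ v → ≈ M i w v → M , v ⊨ₐ φ
M , w ⊨ₐ [∘⁺] i φ = ∀ v → ∘⁺ M i w v → M , v ⊨ₐ φ

_,_⊨f_ : ∀ {g} (M : Model g) → W M → FH g → Set
M , w ⊨f atom p = V M p w
M , w ⊨f (¬f φ) = M , w ⊨f φ → ⊥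
M , w ⊨f (φ ∧f ψ) = (M , w ⊨f φ) × (M , w ⊨f ψ)
M , w ⊨f Af i φ = ∀ p → OccFH p φ → 𝒜 M i w p
M , w ⊨f If i φ = ∀ v → ∼ M i w v → M , v ⊨f φ
M , w ⊨f Ef i φ = (∀ p → OccFH p φ → 𝒜 M i w p)
                 × (∀ v → ∼ M i w v → M , v ⊨f φ)

ValidAIL : ∀ {g} → AIL g → Set₁
ValidAIL {g} φ = (M : Model g) (w : W M) → M , w ⊨ₐ φ

ValidFH : ∀ {g} → FH g → Set₁
ValidFH {g} φ = (M : Model g) (w : W M) → M , w ⊨f φ

t : ∀ {g} → FH g → AIL g
t (atom p) = atom p
t (¬f φ) = ¬ₐ t φ
t (φ ∧f ψ) = t φ ∧ₐ t ψ
t (Af i φ) = Aₐ i (t φ)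
t (If i φ) = Iₐ i (t φ)
t (Ef i φ) = Aₐ i (t φ) ∧ₐ Iₐ i (t φ)

{-# OPTIONS --safe #-}
module Submission where

-- The image of t contains no Eᵢ, [≈]ᵢ or [∘⁺]ᵢ, so the clauses on which the two
-- semantics differ are never consulted, and the FH clause for Eᵢφ is literally
-- the conjunction of those for Aᵢφ and Iᵢφ. Hence t preserves truth at every
-- world of every model, once one checks that t preserves the atoms of a formula,
-- on which the awareness clauses depend.

open import Data.Nat using (ℕ)
open import Data.Product using (_×_; _,_)
open import Data.Product.Function.NonDependent.Propositional using (_×-⇔_)
open import Function.Bundles using (_⇔_; mk⇔; module Equivalence)
open import Function.Construct.Identity using (⇔-id)
open import Function.Related.TypeIsomorphisms using (→-cong-⇔; ¬-cong-⇔)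
open import Defs

open Equivalence using (to; from)

∀-cong-⇔ : ∀ {a b c} {A : Set a} {P : A → Set b} {Q : A → Set c} →
           (∀ x → P x ⇔ Q x) → (∀ x → P x) ⇔ (∀ x → Q x)
∀-cong-⇔ P⇔Q = mk⇔ (λ f x → to (P⇔Q x) (f x)) (λ f x → from (P⇔Q x) (f x))

occ-t⁺ : ∀ {g p} (φ : FH g) → OccFH p φ → OccAIL p (t φ)
occ-t⁺ (atom _) atom     = atom
occ-t⁺ (¬f φ)   (neg o)  = neg (occ-t⁺ φ o)
occ-t⁺ (φ ∧f ψ) (andl o) = andl (occ-t⁺ φ o)
occ-t⁺ (φ ∧f ψ) (andr o) = andr (occ-t⁺ ψ o)
occ-t⁺ (Af i φ) (aw o)   = aw (occ-t⁺ φ o)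
occ-t⁺ (If i φ) (inf o)  = inf (occ-t⁺ φ o)
occ-t⁺ (Ef i φ) (ex o)   = andl (aw (occ-t⁺ φ o))

occ-t⁻ : ∀ {g p} (φ : FH g) → OccAIL p (t φ) → OccFH p φ
occ-t⁻ (atom _) atom           = atom
occ-t⁻ (¬f φ)   (neg o)        = neg (occ-t⁻ φ o)
occ-t⁻ (φ ∧f ψ) (andl o)       = andl (occ-t⁻ φ o)
occ-t⁻ (φ ∧f ψ) (andr o)       = andr (occ-t⁻ ψ o)
occ-t⁻ (Af i φ) (aw o)         = aw (occ-t⁻ φ o)
occ-t⁻ (If i φ) (inf o)        = inf (occ-t⁻ φ o)
occ-t⁻ (Ef i φ) (andl (aw o))  = ex (occ-t⁻ φ o)
occ-t⁻ (Ef i φ) (andr (inf o)) = ex (occ-t⁻ φ o)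

occ-t : ∀ {g p} (φ : FH g) → OccFH p φ ⇔ OccAIL p (t φ)
occ-t φ = mk⇔ (occ-t⁺ φ) (occ-t⁻ φ)

□-cong-⇔ : ∀ {A : Set} (R : A → Set) {P Q : A → Set} →
           (∀ x → P x ⇔ Q x) → (∀ x → R x → P x) ⇔ (∀ x → R x → Q x)
□-cong-⇔ R P⇔Q = ∀-cong-⇔ λ x → →-cong-⇔ (⇔-id (R x)) (P⇔Q x)

aware-t : ∀ {g} (M : Model g) i w (φ : FH g) →
          (M , w ⊨f Af i φ) ⇔ (M , w ⊨ₐ Aₐ i (t φ))
aware-t M i w φ = ∀-cong-⇔ λ p → →-cong-⇔ (occ-t φ) (⇔-id (𝒜 M i w p))

⊨f⇔⊨ₐt : ∀ {g} (M : Model g) (w : W M) (φ : FH g) → (M , w ⊨f φ) ⇔ (M , w ⊨ₐ t φ)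
⊨f⇔⊨ₐt M w (atom p) = ⇔-id (V M p w)
⊨f⇔⊨ₐt M w (¬f φ)   = ¬-cong-⇔ (⊨f⇔⊨ₐt M w φ)
⊨f⇔⊨ₐt M w (φ ∧f ψ) = ⊨f⇔⊨ₐt M w φ ×-⇔ ⊨f⇔⊨ₐt M w ψ
⊨f⇔⊨ₐt M w (Af i φ) = aware-t M i w φ
⊨f⇔⊨ₐt M w (If i φ) = □-cong-⇔ (∼ M i w) λ v → ⊨f⇔⊨ₐt M v φ
⊨f⇔⊨ₐt M w (Ef i φ) = aware-t M i w φ ×-⇔ □-cong-⇔ (∼ M i w) λ v → ⊨f⇔⊨ₐt M v φ

theorem2 : (g : ℕ) (φ : FH g) → (ValidFH φ → ValidAIL (t φ)) × (ValidAIL (t φ) → ValidFH φ)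
theorem2 g φ = (λ valid M w → to (⊨f⇔⊨ₐt M w φ) (valid M w))
             , (λ valid M w → from (⊨f⇔⊨ₐt M w φ) (valid M w))
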